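{- Let $X$ be a finite ordered alphabet, $x,y\in X$, and let $w$ be a permutation of $X$ that is both $x$-decomposable and $y$-decomposable. Then $\phi_x(w)$, $\phi_y(w)$ and $\phi_x\phi_y(w)$ are also both $x$-decomposable and $y$-decomposable, and $\phi_x\phi_y(w)=\phi_y\phi_x(w)$.
   Context: A permutation of a finite ordered alphabet $X$ is a word containing each letter of $X$ exactly once. For $x\in X$, a permutation $w$ is $x$-decomposable if it can be written $w=w_1w_2w_3$ where all letters of $w_1$ and $w_3$ are less than $x$, all letters of $w_2$ are greater than or equal to $x$, and $x$ is the first or last letter of $w_2$. For such $w$, $\phi_x(w)$ denotes the $x$-flip of $w$: the word obtained by moving the letter $x$ from its end of the subword $w_2$ to the other end of $w_2$. -}

module Defs where

open import Data.Nat using (ℕ)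
open import Data.Fin using (Fin; _<_; _≤_)
open import Data.List using (List; []; _∷_; _++_; _∷ʳ_)
open import Data.List.Relation.Unary.All using (All)
open import Data.List.Relation.Unary.Unique.Propositional using (Unique)
open import Data.List.Membership.Propositional using (_∈_)
open import Data.Product using (Σ; _×_; ∃)
open import Data.Sum using (_⊎_)
open import Relation.Binary.PropositionalEquality using (_≡_)

-- The finite ordered alphabet X is modelled as Fin n with its natural order.

IsPermutation : {n : ℕ} → List (Fin n) → Set
IsPermutation {n} w = Unique w × (∀ (a : Fin n) → a ∈ w)

record Decomposition {n : ℕ} (x : Fin n) (w : List (Fin n)) : Set where
  constructor decomp
  field
    w₁ w₂ w₃ : List (Fin n)
    split    : w ≡ w₁ ++ w₂ ++ w₃
    small₁   : All (_< x) w₁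
    small₃   : All (_< x) w₃
    large₂   : All (x ≤_) w₂
    xEnd     : (Σ (List (Fin n)) λ u → w₂ ≡ x ∷ u) ⊎ (Σ (List (Fin n)) λ u → w₂ ≡ u ∷ʳ x)

Decomposable : {n : ℕ} → Fin n → List (Fin n) → Set
Decomposable x w = Decomposition x w

-- Flip x w w' : w' is an x-flip of w, i.e. w' = φ_x(w): for some x-decomposition
-- w = w₁ w₂ w₃, the letter x is moved from its end of w₂ to the other end.
data Flip {n : ℕ} (x : Fin n) : List (Fin n) → List (Fin n) → Set where
  flip-first : ∀ (w₁ u w₃ : List (Fin n)) →
               All (_< x) w₁ → All (_< x) w₃ → All (x ≤_) (x ∷ u) →
               Flip x (w₁ ++ (x ∷ u) ++ w₃) (w₁ ++ (u ∷ʳ x) ++ w₃)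
  flip-last  : ∀ (w₁ u w₃ : List (Fin n)) →
               All (_< x) w₁ → All (_< x) w₃ → All (x ≤_) (u ∷ʳ x) →
               Flip x (w₁ ++ (u ∷ʳ x) ++ w₃) (w₁ ++ (x ∷ u) ++ w₃)

{-# OPTIONS --safe #-}
-- If a < b and w is both a- and b-decomposable, every letter outside the a-block is < a < b,
-- so the b-block lies inside the a-block, strictly between its ends. The b-flip therefore
-- only rearranges the interior of the a-block, while the a-flip only moves a across that
-- interior; the two flips act independently and commute, and the decompositions they leave
-- behind are read off directly. The a-block of a word is always unique, and in a permutation
-- a occurs only once in it, so the a-flip is unique too: "some flip" becomes "the flip".
module Submission where

open import Defs
open import Data.Nat using (ℕ)
open import Data.Fin using (Fin)
open import Data.List using (List)
open import Data.Product using (Σ; _×_)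
open import Relation.Binary.PropositionalEquality using (_≡_)

open import Data.Fin using (_<_; _≤_)
open import Data.Fin.Properties using (<-cmp; ≤-refl; <-trans)
import Data.Nat.Properties as ℕ
open import Data.List using ([]; _∷_; _++_; _∷ʳ_)
open import Data.List.Properties using (++-identityʳ; ++-monoid; ∷-injective; ∷-injectiveˡ; ∷-injectiveʳ; ∷ʳ-injective)
open import Data.List.Relation.Unary.All as All using (All; []; _∷_)
open import Data.List.Relation.Unary.All.Properties using (++⁺; ++⁻ˡ; ++⁻ʳ; ∷ʳ⁺; ∷ʳ⁻)
open import Data.List.Relation.Unary.Any using (here)
open import Data.List.Relation.Unary.Unique.Propositional using (Unique)
open import Data.List.Relation.Unary.Unique.Propositional.Properties using (Unique[x∷xs]⇒x∉xs)
open import Data.List.Membership.Propositional using (_∉_)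
open import Data.List.Membership.Propositional.Properties using (∈-++⁺ˡ; ∈-++⁺ʳ)
open import Data.Product using (∃; ∃₂; _,_; proj₁; proj₂)
open import Data.Sum using (inj₁; inj₂)
open import Data.Empty using (⊥-elim)
open import Function using (_∘_)
open import Relation.Nullary using (¬_)
open import Relation.Binary using (tri<; tri≈; tri>)
open import Relation.Binary.PropositionalEquality using (refl; sym; trans; cong; subst; _≢_; setoid)
import Data.List.Relation.Binary.Permutation.Setoid as Permutation
import Data.List.Relation.Binary.Permutation.Setoid.Properties as Permutationₚ
open import Tactic.MonoidSolver using (solve)

private
  variable
    A : Set
    P : A → Set
    n : ℕ

  module _ {A : Set} where
    open Permutation (setoid A) public using (_↭_; ↭-refl; ↭-sym; ↭-trans)
    open Permutationₚ (setoid A) public using (Unique-resp-↭; zoom; shifts; ++⁺ʳ; ∷↭∷ʳ)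

All⇒All¬⇒[] : {xs : List A} → All P xs → All (¬_ ∘ P) xs → xs ≡ []
All⇒All¬⇒[] []       []         = refl
All⇒All¬⇒[] (p ∷ _) (¬p ∷ _) = ⊥-elim (¬p p)

block-prefix : ∀ {B : List A} u {R q} → All P B → All (¬_ ∘ P) R →
               u ++ R ≡ B ++ q → ∃ λ e → u ≡ B ++ e × q ≡ e ++ R
block-prefix {B = []}    u       _         _          eq   = u , refl , sym eq
block-prefix {B = c ∷ B} []      (pc ∷ _) (¬pc ∷ _) refl = ⊥-elim (¬pc pc)
block-prefix {B = c ∷ B} (z ∷ u) (_ ∷ pB) ¬pR       eq
  with refl , eq′ ← ∷-injective eq
  with e , u≡ , q≡ ← block-prefix u pB ¬pR eq′
  = e , cong (c ∷_) u≡ , q≡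

block-after : ∀ L {s p B q} → All (¬_ ∘ P) L → All P B → B ≢ [] →
              L ++ s ≡ p ++ B ++ q → ∃ λ d → p ≡ L ++ d × s ≡ d ++ B ++ q
block-after []      _          _         _   eq = _ , refl , eq
block-after (z ∷ L) {p = []}    {[]}     _          _         B≢[] _  = ⊥-elim (B≢[] refl)
block-after (z ∷ L) {p = []}    {c ∷ B}  (¬pz ∷ _) (pc ∷ _) _    eq =
  ⊥-elim (¬pz (subst _ (sym (∷-injectiveˡ eq)) pc))
block-after (z ∷ L) {p = z′ ∷ p}         (_ ∷ ¬pL)  pB        B≢[] eq
  with refl , eq′ ← ∷-injective eq
  with d , p≡ , s≡ ← block-after L ¬pL pB B≢[] eq′
  = d , cong (z ∷_) p≡ , s≡

block-before : ∀ d {u R B q} → All (¬_ ∘ P) R → All P B → B ≢ [] →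
               u ++ R ≡ d ++ B ++ q → ∃ λ e → u ≡ d ++ B ++ e × q ≡ e ++ R
block-before []      ¬pR pB _    eq = block-prefix _ pB ¬pR eq
block-before (c ∷ d) {[]}    ¬pR pB B≢[] refl =
  ⊥-elim (B≢[] (All⇒All¬⇒[] pB (++⁻ˡ _ (++⁻ʳ d (All.tail ¬pR)))))
block-before (c ∷ d) {z ∷ u} ¬pR pB B≢[] eq
  with refl , eq′ ← ∷-injective eq
  with e , u≡ , q≡ ← block-before d ¬pR pB B≢[] eq′
  = e , cong (c ∷_) u≡ , q≡

block-inside : ∀ L {u R p B q} → All (¬_ ∘ P) L → All (¬_ ∘ P) R → All P B → B ≢ [] →
               L ++ u ++ R ≡ p ++ B ++ q →
               ∃₂ λ d e → u ≡ d ++ B ++ e × p ≡ L ++ d × q ≡ e ++ R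
block-inside L ¬pL ¬pR pB B≢[] eq
  with d , p≡ , eq′ ← block-after L ¬pL pB B≢[] eq
  with e , u≡ , q≡ ← block-before d ¬pR pB B≢[] eq′
  = d , e , u≡ , p≡ , q≡

block-unique : ∀ {L B R L′ B′ R′ : List A} →
               All (¬_ ∘ P) L → All P B → All (¬_ ∘ P) R →
               All (¬_ ∘ P) L′ → All P B′ → All (¬_ ∘ P) R′ → B′ ≢ [] →
               L ++ B ++ R ≡ L′ ++ B′ ++ R′ → L ≡ L′ × B ≡ B′ × R ≡ R′
block-unique {L = L} {B} {R} {L′} {B′} {R′} ¬pL pB ¬pR ¬pL′ pB′ ¬pR′ B′≢[] eq
  with d , e , B≡ , refl , refl ← block-inside L {B} {R} {L′} {B′} {R′} ¬pL ¬pR pB′ B′≢[] eq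
  with refl ← All⇒All¬⇒[] (++⁻ˡ d (subst (All _) B≡ pB)) (++⁻ʳ L ¬pL′)
  with refl ← All⇒All¬⇒[] (++⁻ʳ B′ (subst (All _) B≡ pB)) (++⁻ˡ e ¬pR′)
  = sym (++-identityʳ L) , trans B≡ (++-identityʳ B′) , refl

data End : Set where
  first last : End

opposite : End → End
opposite first = last
opposite last  = first

block : End → A → List A → List A
block first a u = a ∷ u
block last  a u = u ∷ʳ a

lead trail : End → A → List A
lead first a = a ∷ []
lead last  a = []
trail first a = []
trail last  a = a ∷ []

block≡lead++trail : ∀ s (a : A) u → block s a u ≡ lead s a ++ u ++ trail s a
block≡lead++trail first a u = cong (a ∷_) (sym (++-identityʳ u))
block≡lead++trail last  a u = refl

block-regroup : ∀ (L : List A) s a d X e R →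
                L ++ block s a (d ++ X ++ e) ++ R ≡ ((L ++ lead s a) ++ d) ++ X ++ (e ++ (trail s a ++ R))
block-regroup {A} L s a d X e R
  rewrite block≡lead++trail s a (d ++ X ++ e) = solve (++-monoid A)

block-unfold : ∀ (L : List A) s a u R → L ++ block s a u ++ R ≡ (L ++ lead s a) ++ u ++ (trail s a ++ R)
block-unfold {A} L s a u R rewrite block≡lead++trail s a u = solve (++-monoid A)

block⁺ : ∀ s {a : A} {u} → P a → All P u → All P (block s a u)
block⁺ first pa pu = pa ∷ pu
block⁺ last  pa pu = ∷ʳ⁺ pu pa

block⁻ : ∀ s {a : A} {u} → All P (block s a u) → All P u
block⁻ first = All.tail
block⁻ last  = proj₁ ∘ ∷ʳ⁻

lead⁺ : ∀ s {a : A} → P a → All P (lead s a)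
lead⁺ first pa = pa ∷ []
lead⁺ last  pa = []

trail⁺ : ∀ s {a : A} → P a → All P (trail s a)
trail⁺ first pa = []
trail⁺ last  pa = pa ∷ []

block≢[] : ∀ s (a : A) u → block s a u ≢ []
block≢[] first a u      ()
block≢[] last  a []      ()
block≢[] last  a (_ ∷ _) ()

block↭ : ∀ s (a : A) u → block s a u ↭ a ∷ u
block↭ first a u = ↭-refl
block↭ last  a u = ↭-sym (∷↭∷ʳ a u)

∷≡∷ʳ⇒singleton : ∀ {a : A} {u u′} → a ∉ u → a ∷ u ≡ u′ ∷ʳ a → u ≡ [] × u′ ≡ []
∷≡∷ʳ⇒singleton {u′ = []}     _   refl = refl , refl
∷≡∷ʳ⇒singleton {u′ = _ ∷ u′} a∉u refl = ⊥-elim (a∉u (∈-++⁺ʳ u′ (here refl)))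

opposite-block-unique : ∀ s s′ {a : A} {u u′} → a ∉ u → a ∉ u′ →
                        block s a u ≡ block s′ a u′ → block (opposite s) a u ≡ block (opposite s′) a u′
opposite-block-unique first first _ _ eq = cong (_∷ʳ _) (∷-injectiveʳ eq)
opposite-block-unique last  last  _ _ eq = cong (_ ∷_) (proj₁ (∷ʳ-injective _ _ eq))
opposite-block-unique first last a∉u _ eq
  with refl , refl ← ∷≡∷ʳ⇒singleton a∉u eq = refl
opposite-block-unique last first _ a∉u′ eq
  with refl , refl ← ∷≡∷ʳ⇒singleton a∉u′ (sym eq) = refl

Unique⇒∉block : ∀ (L : List A) s a u R → Unique (L ++ block s a u ++ R) → a ∉ u
Unique⇒∉block L s a u R uniq a∈u = Unique[x∷xs]⇒x∉xs moved (∈-++⁺ˡ a∈u)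
  where
    moved : Unique (a ∷ u ++ L ++ R)
    moved = Unique-resp-↭ (↭-trans (shifts L (block s a u)) (++⁺ʳ (L ++ R) (block↭ s a u))) uniq

-- The paper's w₂ is  block end a inner.
record EndDecomposition (a : Fin n) (w : List (Fin n)) : Set where
  constructor end-decomp
  field
    left inner right : List (Fin n)
    end    : End
    splits : w ≡ left ++ block end a inner ++ right
    left<  : All (_< a) left
    right< : All (_< a) right
    inner≥ : All (a ≤_) inner

open EndDecomposition

module _ {a : Fin n} where

  All<⇒All≱ : {xs : List (Fin n)} → All (_< a) xs → All (¬_ ∘ (a ≤_)) xs
  All<⇒All≱ = All.map ℕ.<⇒≱

  All<-weaken : {b : Fin n} {xs : List (Fin n)} → a < b → All (_< a) xs → All (_< b) xs
  All<-weaken a<b = All.map (λ x<a → <-trans x<a a<b)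

  All≥-weaken : {b : Fin n} {xs : List (Fin n)} → a < b → All (b ≤_) xs → All (a ≤_) xs
  All≥-weaken a<b = All.map (λ b≤x → ℕ.<⇒≤ (ℕ.<-≤-trans a<b b≤x))

flipAt : {a : Fin n} {w : List (Fin n)} → EndDecomposition a w → List (Fin n)
flipAt {a = a} D = left D ++ block (opposite (end D)) a (inner D) ++ right D

flipped : {a : Fin n} {w : List (Fin n)} (D : EndDecomposition a w) → EndDecomposition a (flipAt D)
flipped (end-decomp L u R s _ L< R< u≥) = end-decomp L u R (opposite s) refl L< R< u≥

module _ {a : Fin n} where

  fromDecomposable : ∀ {w} → Decomposable a w → EndDecomposition a w
  fromDecomposable (decomp L _ R w≡ L< R< B≥ (inj₁ (u , refl))) = end-decomp L u R first w≡ L< R< (block⁻ first B≥)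
  fromDecomposable (decomp L _ R w≡ L< R< B≥ (inj₂ (u , refl))) = end-decomp L u R last  w≡ L< R< (block⁻ last B≥)

  toDecomposable : ∀ {w} → EndDecomposition a w → Decomposable a w
  toDecomposable (end-decomp L u R first w≡ L< R< u≥) =
    decomp L (a ∷ u) R w≡ L< R< (block⁺ first ≤-refl u≥) (inj₁ (u , refl))
  toDecomposable (end-decomp L u R last  w≡ L< R< u≥) =
    decomp L (u ∷ʳ a) R w≡ L< R< (block⁺ last ≤-refl u≥) (inj₂ (u , refl))

  toFlip : ∀ {w} (D : EndDecomposition a w) → Flip a w (flipAt D)
  toFlip (end-decomp L u R first refl L< R< u≥) = flip-first L u R L< R< (block⁺ first ≤-refl u≥)
  toFlip (end-decomp L u R last  refl L< R< u≥) = flip-last  L u R L< R< (block⁺ last ≤-refl u≥)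

  fromFlip : ∀ {w w′} → Flip a w w′ → Σ (EndDecomposition a w) λ D → w′ ≡ flipAt D
  fromFlip (flip-first L u R L< R< B≥) = end-decomp L u R first refl L< R< (block⁻ first B≥) , refl
  fromFlip (flip-last  L u R L< R< B≥) = end-decomp L u R last  refl L< R< (block⁻ last B≥) , refl

  Flip⇒Decomposableˡ : ∀ {w w′} → Flip a w w′ → Decomposable a w
  Flip⇒Decomposableˡ = toDecomposable ∘ proj₁ ∘ fromFlip

  Flip⇒Decomposableʳ : ∀ {w w′} → Flip a w w′ → Decomposable a w′
  Flip⇒Decomposableʳ f with D , refl ← fromFlip f = toDecomposable (flipped D)

  Flip⇒↭ : ∀ {w w′} → Flip a w w′ → w ↭ w′
  Flip⇒↭ (flip-first L u R _ _ _) = zoom L (∷↭∷ʳ a u)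
  Flip⇒↭ (flip-last  L u R _ _ _) = zoom L (↭-sym (∷↭∷ʳ a u))

  flipAt-unique : ∀ {w} → Unique w → (D D′ : EndDecomposition a w) → flipAt D ≡ flipAt D′
  flipAt-unique uniq (end-decomp L u R s refl L< R< u≥) (end-decomp L′ u′ R′ s′ w≡ L′< R′< u′≥)
    with refl , B≡ , refl ← block-unique (All<⇒All≱ L<) (block⁺ s ≤-refl u≥) (All<⇒All≱ R<)
                                         (All<⇒All≱ L′<) (block⁺ s′ ≤-refl u′≥) (All<⇒All≱ R′<)
                                         (block≢[] s′ a u′) w≡
    = cong (λ B → L ++ B ++ R) (opposite-block-unique s s′ (Unique⇒∉block L s a u R uniq)
                                  (Unique⇒∉block L s′ a u′ R (subst Unique w≡ uniq)) B≡)

  Flip-functional : ∀ {w w′ w″} → Unique w → Flip a w w′ → Flip a w w″ → w′ ≡ w″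
  Flip-functional uniq f g
    with D , refl ← fromFlip f | D′ , refl ← fromFlip g = flipAt-unique uniq D D′

record CommutingFlips (a b : Fin n) (w : List (Fin n)) : Set where
  field
    wa wb wab      : List (Fin n)
    flip-a         : Flip a w wa
    flip-b         : Flip b w wb
    flip-a-after-b : Flip a wb wab
    flip-b-after-a : Flip b wa wab

CommutingFlips-sym : {a b : Fin n} {w : List (Fin n)} → CommutingFlips a b w → CommutingFlips b a w
CommutingFlips-sym F = record
  { wa = wb ; wb = wa ; wab = wab ; flip-a = flip-b ; flip-b = flip-a
  ; flip-a-after-b = flip-b-after-a ; flip-b-after-a = flip-a-after-b }
  where open CommutingFlips F

commutingFlips-≡ : {a : Fin n} {w : List (Fin n)} → EndDecomposition a w → CommutingFlips a a w
commutingFlips-≡ D = record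
  { wa = flipAt D ; wb = flipAt D ; wab = flipAt (flipped D) ; flip-a = toFlip D ; flip-b = toFlip D
  ; flip-a-after-b = toFlip (flipped D) ; flip-b-after-a = toFlip (flipped D) }

commutingFlips-< : {a b : Fin n} {w : List (Fin n)} → a < b →
                   EndDecomposition a w → EndDecomposition b w → CommutingFlips a b w
commutingFlips-< {a = a} {b} a<b D@(end-decomp L u R s refl L< R< u≥) E@(end-decomp p v q t w≡ p< q< v≥)
  with d , e , refl , refl , refl ←
       block-inside (L ++ lead s a) {u} {trail s a ++ R} {p} {block t b v} {q} (All<⇒All≱ (++⁺ (All<-weaken a<b L<) (lead⁺ s a<b)))
                    (All<⇒All≱ (++⁺ (trail⁺ s a<b) (All<-weaken a<b R<)))
                    (block⁺ t ≤-refl v≥) (block≢[] t b v) (trans (sym (block-unfold L s a u R)) w≡)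
  = record
  { wa = flipAt D ; wb = flipAt E ; wab = flipAt Eb
  ; flip-a = toFlip D ; flip-b = toFlip E ; flip-a-after-b = toFlip Eb
  ; flip-b-after-a = subst (Flip b (flipAt D)) (sym (block-regroup L s′ a d B′ e R)) (toFlip Da) }
  where
    s′ = opposite s
    B′ = block (opposite t) b v
    d<b : All (_< b) d
    d<b = ++⁻ʳ (L ++ lead s a) p<
    e<b : All (_< b) e
    e<b = ++⁻ˡ e q<
    d+e≥ : All (a ≤_) d × All (a ≤_) e
    d+e≥ = ++⁻ˡ d u≥ , ++⁻ʳ (block t b v) (++⁻ʳ d u≥)
    Eb : EndDecomposition a (flipAt E)
    Eb = end-decomp L (d ++ B′ ++ e) R s (sym (block-regroup L s a d B′ e R)) L< R<
           (++⁺ (proj₁ d+e≥) (++⁺ (All≥-weaken a<b (block⁺ (opposite t) ≤-refl v≥)) (proj₂ d+e≥)))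
    Da : EndDecomposition b (flipAt D)
    Da = end-decomp ((L ++ lead s′ a) ++ d) v (e ++ (trail s′ a ++ R)) t (block-regroup L s′ a d (block t b v) e R)
           (++⁺ (++⁺ (All<-weaken a<b L<) (lead⁺ s′ a<b)) d<b)
           (++⁺ e<b (++⁺ (trail⁺ s′ a<b) (All<-weaken a<b R<))) v≥

commutingFlips : {x y : Fin n} {w : List (Fin n)} → Decomposable x w → Decomposable y w → CommutingFlips x y w
commutingFlips {x = x} {y} dx dy with <-cmp x y
... | tri< x<y _ _  = commutingFlips-< x<y (fromDecomposable dx) (fromDecomposable dy)
... | tri≈ _ refl _ = commutingFlips-≡ (fromDecomposable dx)
... | tri> _ _ y<x  = CommutingFlips-sym (commutingFlips-< y<x (fromDecomposable dy) (fromDecomposable dx))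

corollary5p3 : ∀ (n : ℕ) (x y : Fin n) (w : List (Fin n)) →
    IsPermutation w → Decomposable x w → Decomposable y w →
    ((∀ wx → Flip x w wx → Decomposable x wx × Decomposable y wx)
    × (∀ wy → Flip y w wy → Decomposable x wy × Decomposable y wy)
    × (∀ wy wxy → Flip y w wy → Flip x wy wxy → Decomposable x wxy × Decomposable y wxy)
    × (∀ wx wy wxy wyx → Flip x w wx → Flip y w wy → Flip x wy wxy → Flip y wx wyx → wxy ≡ wyx)
    × (Σ (List (Fin n)) λ wy → Σ (List (Fin n)) λ wxy → Flip y w wy × Flip x wy wxy
    × (Σ (List (Fin n)) λ wx → Flip x w wx × Flip y wx wxy)))
corollary5p3 n x y w (uniq , _) dx dy =
    (λ _ fx → Flip⇒Decomposableʳ fx , subst (Decomposable y) (sym (≡wa fx)) (Flip⇒Decomposableˡ flip-b-after-a))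
  , (λ _ fy → subst (Decomposable x) (sym (≡wb fy)) (Flip⇒Decomposableˡ flip-a-after-b) , Flip⇒Decomposableʳ fy)
  , (λ _ _ fy fxy → Flip⇒Decomposableʳ fxy
                  , subst (Decomposable y) (sym (≡wab-via-b fy fxy)) (Flip⇒Decomposableʳ flip-b-after-a))
  , (λ _ _ _ _ fx fy fxy fyx → trans (≡wab-via-b fy fxy) (sym (≡wab-via-a fx fyx)))
  , (wb , wab , flip-b , flip-a-after-b , wa , flip-a , flip-b-after-a)
  where
    open CommutingFlips (commutingFlips dx dy)
    ≡wa : ∀ {wx} → Flip x w wx → wx ≡ wa
    ≡wa fx = Flip-functional uniq fx flip-a
    ≡wb : ∀ {wy} → Flip y w wy → wy ≡ wb
    ≡wb fy = Flip-functional uniq fy flip-b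
    ≡wab-via-b : ∀ {wy wxy} → Flip y w wy → Flip x wy wxy → wxy ≡ wab
    ≡wab-via-b fy fxy with refl ← ≡wb fy = Flip-functional (Unique-resp-↭ (Flip⇒↭ flip-b) uniq) fxy flip-a-after-b
    ≡wab-via-a : ∀ {wx wyx} → Flip x w wx → Flip y wx wyx → wyx ≡ wab
    ≡wab-via-a fx fyx with refl ← ≡wa fx = Flip-functional (Unique-resp-↭ (Flip⇒↭ flip-a) uniq) fyx flip-b-after-a
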